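{- Let $L$ be any normal modal logic satisfying $\Gamma(\mathbf{LP}_2,1,\omega)\subseteq L\subseteq\Gamma(\mathbf{LS},1,2)$. Then $L$ does not have the Lyndon interpolation property.
   Context: Modal formulas use variables, $\bot,\land,\lor,\neg,\to,\Box$. Positive/negative variables: $v^+(p)=\{p\}$, $v^-(p)=\emptyset$, $v^\circ(\bot)=\emptyset$, $\land,\lor,\Box$ preserve polarity, $v^\pm(\neg\varphi)=v^\mp(\varphi)$, $v^+(\varphi\to\psi)=v^-(\varphi)\cup v^+(\psi)$, $v^-(\varphi\to\psi)=v^+(\varphi)\cup v^-(\psi)$. Kripke frames have reflexive transitive relations. $\Gamma(\mathbf{LP}_2,1,\omega)$ is the set of modal formulas true at every world of every Kripke model on every finite frame of the form $W=I\cup F$ with $I,F$ disjoint finite nonempty sets, where $xRy$ holds iff $x\in I$, or $x=y$ (so $I$ is a cluster seeing everything and each element of $F$ is a final point seeing only itself). $\Gamma(\mathbf{LS},1,2)$ is the set of modal formulas true at every world of every Kripke model on the frame $W=\{a,b,c\}$ with $R$ the reflexive transitive closure of $\{(a,b),(b,a),(a,c),(b,c)\}$. A logic $L$ has the Lyndon interpolation property iff whenever $L\vdash\varphi\to\psi$ there is $\rho$ with $v^\circ(\rho)\subseteq v^\circ(\varphi)\cap v^\circ(\psi)$ for $\circ\in\{+,-\}$, $L\vdash\varphi\to\rho$ and $L\vdash\rho\to\psi$. -}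

module Defs where

open import Data.Nat using (ℕ; suc)
open import Data.Bool using (Bool; true; false; _∧_; _∨_; not)
open import Data.Fin using (Fin; zero; suc)
open import Data.Sum using (_⊎_; inj₁; inj₂)
open import Data.Product using (_×_; Σ-syntax)
open import Data.Empty renaming (⊥ to Empty)
open import Relation.Nullary using (¬_)
open import Relation.Binary.PropositionalEquality using (_≡_)
open import Relation.Binary.Construct.Closure.ReflexiveTransitive using (Star)

infixr 5 _⇒_
infixr 6 _∨ₘ_
infixr 7 _∧ₘ_
data Fm : Set where
  var  : ℕ → Fm
  ⊥ₘ   : Fm
  _∧ₘ_ : Fm → Fm → Fm
  _∨ₘ_ : Fm → Fm → Fm
  ¬ₘ_  : Fm → Fm
  _⇒_  : Fm → Fm → Fm
  □_   : Fm → Fm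

mutual
  Pos : Fm → ℕ → Set
  Pos (var q)   p = q ≡ p
  Pos ⊥ₘ        p = Empty
  Pos (φ ∧ₘ ψ)  p = Pos φ p ⊎ Pos ψ p
  Pos (φ ∨ₘ ψ)  p = Pos φ p ⊎ Pos ψ p
  Pos (¬ₘ φ)    p = Neg φ p
  Pos (φ ⇒ ψ)   p = Neg φ p ⊎ Pos ψ p
  Pos (□ φ)     p = Pos φ p

  Neg : Fm → ℕ → Set
  Neg (var q)   p = Empty
  Neg ⊥ₘ        p = Empty
  Neg (φ ∧ₘ ψ)  p = Neg φ p ⊎ Neg ψ p
  Neg (φ ∨ₘ ψ)  p = Neg φ p ⊎ Neg ψ p
  Neg (¬ₘ φ)    p = Pos φ p
  Neg (φ ⇒ ψ)   p = Pos φ p ⊎ Neg ψ p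
  Neg (□ φ)     p = Neg φ p

-- Propositional tautologies (variables and boxed formulas are atoms)

evalP : (Fm → Bool) → Fm → Bool
evalP v (var p)  = v (var p)
evalP v ⊥ₘ       = false
evalP v (φ ∧ₘ ψ) = evalP v φ ∧ evalP v ψ
evalP v (φ ∨ₘ ψ) = evalP v φ ∨ evalP v ψ
evalP v (¬ₘ φ)   = not (evalP v φ)
evalP v (φ ⇒ ψ)  = not (evalP v φ) ∨ evalP v ψ
evalP v (□ φ)    = v (□ φ)

Tautology : Fm → Set
Tautology φ = (v : Fm → Bool) → evalP v φ ≡ true

sub : (ℕ → Fm) → Fm → Fm
sub σ (var p)  = σ p
sub σ ⊥ₘ       = ⊥ₘ
sub σ (φ ∧ₘ ψ) = sub σ φ ∧ₘ sub σ ψ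
sub σ (φ ∨ₘ ψ) = sub σ φ ∨ₘ sub σ ψ
sub σ (¬ₘ φ)   = ¬ₘ sub σ φ
sub σ (φ ⇒ ψ)  = sub σ φ ⇒ sub σ ψ
sub σ (□ φ)    = □ sub σ φ

record NormalModalLogic (L : Fm → Set) : Set where
  field
    taut  : ∀ φ → Tautology φ → L φ
    axK   : ∀ φ ψ → L (□ (φ ⇒ ψ) ⇒ (□ φ ⇒ □ ψ))
    mp    : ∀ φ ψ → L (φ ⇒ ψ) → L φ → L ψ
    nec   : ∀ φ → L φ → L (□ φ)
    subst : ∀ σ φ → L φ → L (sub σ φ)

sat : {W : Set} → (W → W → Set) → (ℕ → W → Bool) → W → Fm → Set
sat R V x (var p)  = V p x ≡ true
sat R V x ⊥ₘ       = Empty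
sat R V x (φ ∧ₘ ψ) = sat R V x φ × sat R V x ψ
sat R V x (φ ∨ₘ ψ) = sat R V x φ ⊎ sat R V x ψ
sat R V x (¬ₘ φ)   = ¬ sat R V x φ
sat R V x (φ ⇒ ψ)  = sat R V x φ → sat R V x ψ
sat {W} R V x (□ φ) = (y : W) → R x y → sat R V y φ

-- The frames LP₂ with I = Fin (suc i), F = Fin (suc f) (finite, nonempty)
-- W = I ⊎ F ;  x R y  iff  x ∈ I  or  x = y

WLP : ℕ → ℕ → Set
WLP i f = Fin (suc i) ⊎ Fin (suc f)

RLP : ∀ {i f} → WLP i f → WLP i f → Set
RLP x y = (Σ[ a ∈ Fin _ ] x ≡ inj₁ a) ⊎ x ≡ y

Γ-LP₂-1-ω : Fm → Set
Γ-LP₂-1-ω φ = (i f : ℕ) (V : ℕ → WLP i f → Bool) (x : WLP i f) →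
  sat RLP V x φ

a b c : Fin 3
a = zero
b = suc zero
c = suc (suc zero)

data RLS-base : Fin 3 → Fin 3 → Set where
  ab : RLS-base a b
  ba : RLS-base b a
  ac : RLS-base a c
  bc : RLS-base b c

RLS : Fin 3 → Fin 3 → Set
RLS = Star RLS-base

Γ-LS-1-2 : Fm → Set
Γ-LS-1-2 φ = (V : ℕ → Fin 3 → Bool) (x : Fin 3) → sat RLS V x φ

LyndonInterpolation : (Fm → Set) → Set
LyndonInterpolation L = ∀ φ ψ → L (φ ⇒ ψ) →
  Σ[ ρ ∈ Fm ]
    (∀ p → Pos ρ p → Pos φ p × Pos ψ p) ×
    (∀ p → Neg ρ p → Neg φ p × Neg ψ p) ×
    L (φ ⇒ ρ) × L (ρ ⇒ ψ)

{-# OPTIONS --safe #-}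
-- On LP₂ frames, if p₀ fails
-- at x then the ◇-witness y of φ₀ cannot be a final point, so it lies in the cluster, sees x
-- and thereby witnesses ψ₀.  A Lyndon interpolant ρ can have no negative variable, because p₁
-- is the only negative variable of φ₀ and p₀ the only one of ψ₀.  Such formulas are preserved
-- along a bisimulation that is monotone on the valuations.  On the LS frame, one such
-- bisimulation links a model of φ₀ at a to a model refuting ψ₀ at a, so ρ ⇒ ψ₀ is not in L.
module Submission where

open import Defs
open import Relation.Nullary using (¬_; yes; no)
open import Relation.Nullary.Decidable using (⌊_⌋)
open import Relation.Unary using (Pred; _⊆_; U; ∅)
open import Level using (0ℓ)
open import Function using (_∘_; flip)
open import Data.Nat using (ℕ)
open import Data.Bool using (Bool; true)
open import Data.Bool.Properties using () renaming (_≟_ to _≟ᵇ_)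
open import Data.Fin using (Fin; zero; suc)
open import Data.Fin.Properties using (_≟_)
open import Data.Sum using (inj₁; inj₂)
import Data.Sum as Sum
open import Data.Product using (∃-syntax; _×_; _,_)
open import Data.Empty using (⊥-elim)
open import Relation.Binary.PropositionalEquality using (_≡_; refl; sym; trans; subst)
open import Relation.Binary.Construct.Closure.ReflexiveTransitive using (Star; ε; _◅_; _◅◅_)

Forth : {W₁ W₂ : Set} → (W₁ → W₁ → Set) → (W₂ → W₂ → Set) → (W₁ → W₂ → Set) → Set
Forth R₁ R₂ Z =
  ∀ {w₁ w₂ v₁} → Z w₁ w₂ → R₁ w₁ v₁ → ∃[ v₂ ] R₂ w₂ v₂ × Z v₁ v₂

forth-star : {W₁ W₂ : Set} {R₁ : W₁ → W₁ → Set} {R₂ : W₂ → W₂ → Set} {Z : W₁ → W₂ → Set} →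
             Forth R₁ (Star R₂) Z → Forth (Star R₁) (Star R₂) Z
forth-star zig z ε = _ , ε , z
forth-star zig z (r ◅ rs) with zig z r
... | _ , s , z′ with forth-star zig z′ rs
... | v₂ , ss , z″ = v₂ , s ◅◅ ss , z″

module Transfer {W₁ W₂ : Set} (R₁ : W₁ → W₁ → Set) (R₂ : W₂ → W₂ → Set)
  (V₁ : ℕ → W₁ → Bool) (V₂ : ℕ → W₂ → Bool) (Z : W₁ → W₂ → Set)
  (zig : Forth R₁ R₂ Z) (zag : Forth R₂ R₁ (flip Z)) (P N : Pred ℕ 0ℓ)
  (mono : ∀ {q w₁ w₂} → P q → Z w₁ w₂ → V₁ q w₁ ≡ true → V₂ q w₂ ≡ true)
  (anti : ∀ {q w₁ w₂} → N q → Z w₁ w₂ → V₂ q w₂ ≡ true → V₁ q w₁ ≡ true)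
  where

  mutual
    preserve : ∀ χ → Pos χ ⊆ P → Neg χ ⊆ N →
               ∀ {w₁ w₂} → Z w₁ w₂ → sat R₁ V₁ w₁ χ → sat R₂ V₂ w₂ χ
    preserve (var q)  pos neg z s = mono (pos refl) z s
    preserve ⊥ₘ       pos neg z ()
    preserve (χ ∧ₘ θ) pos neg z (s , t) =
      preserve χ (pos ∘ inj₁) (neg ∘ inj₁) z s , preserve θ (pos ∘ inj₂) (neg ∘ inj₂) z t
    preserve (χ ∨ₘ θ) pos neg z =
      Sum.map (preserve χ (pos ∘ inj₁) (neg ∘ inj₁) z) (preserve θ (pos ∘ inj₂) (neg ∘ inj₂) z)
    preserve (¬ₘ χ)   pos neg z s = s ∘ reflect χ neg pos z
    preserve (χ ⇒ θ)  pos neg z s =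
      preserve θ (pos ∘ inj₂) (neg ∘ inj₂) z ∘ s ∘ reflect χ (neg ∘ inj₁) (pos ∘ inj₁) z
    preserve (□ χ)    pos neg z s v₂ r with zag z r
    ... | v₁ , r₁ , z′ = preserve χ pos neg z′ (s v₁ r₁)

    reflect : ∀ χ → Pos χ ⊆ N → Neg χ ⊆ P →
              ∀ {w₁ w₂} → Z w₁ w₂ → sat R₂ V₂ w₂ χ → sat R₁ V₁ w₁ χ
    reflect (var q)  pos neg z s = anti (pos refl) z s
    reflect ⊥ₘ       pos neg z ()
    reflect (χ ∧ₘ θ) pos neg z (s , t) =
      reflect χ (pos ∘ inj₁) (neg ∘ inj₁) z s , reflect θ (pos ∘ inj₂) (neg ∘ inj₂) z t
    reflect (χ ∨ₘ θ) pos neg z =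
      Sum.map (reflect χ (pos ∘ inj₁) (neg ∘ inj₁) z) (reflect θ (pos ∘ inj₂) (neg ∘ inj₂) z)
    reflect (¬ₘ χ)   pos neg z s = s ∘ preserve χ neg pos z
    reflect (χ ⇒ θ)  pos neg z s =
      reflect θ (pos ∘ inj₂) (neg ∘ inj₂) z ∘ s ∘ preserve χ (neg ∘ inj₁) (pos ∘ inj₁) z
    reflect (□ χ)    pos neg z s v₁ r with zig z r
    ... | v₂ , r₂ , z′ = reflect χ pos neg z′ (s v₂ r₂)

◇_ : Fm → Fm
◇ χ = ¬ₘ □ ¬ₘ χ

Final : {W : Set} → (W → W → Set) → W → Set
Final R y = ∀ z → R y z → z ≡ y

module Diamond {W : Set} (R : W → W → Set) (V : ℕ → W → Bool) where

  ◇-intro : ∀ {x y} χ → R x y → sat R V y χ → sat R V x (◇ χ)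
  ◇-intro {y = y} _ r s □¬χ = □¬χ y r s

  ◇-map : ∀ {x} χ θ → (∀ y → R x y → sat R V y χ → sat R V y θ) →
          sat R V x (◇ χ) → sat R V x (◇ θ)
  ◇-map _ _ f ◇χ □¬θ = ◇χ λ y r → □¬θ y r ∘ f y r

  final-◇¬-refutes : ∀ {y} χ → Final R y → sat R V y (◇ ¬ₘ χ) → ¬ sat R V y χ
  final-◇¬-refutes χ fin ◇¬χ s =
    ◇¬χ λ z r ¬χ → ¬χ (subst (λ w → sat R V w χ) (sym (fin z r)) s)

φ₀ ψ₀ : Fm
φ₀ = ¬ₘ var 1 ∧ₘ ◇ (var 1 ∧ₘ var 0 ∧ₘ ◇ ¬ₘ var 1)
ψ₀ = var 0 ∨ₘ ◇ (var 0 ∧ₘ ◇ ¬ₘ var 0)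

Neg-φ₀ : ∀ {q} → Neg φ₀ q → q ≡ 1
Neg-φ₀ (inj₁ e)                 = sym e
Neg-φ₀ (inj₂ (inj₁ ()))
Neg-φ₀ (inj₂ (inj₂ (inj₁ ())))
Neg-φ₀ (inj₂ (inj₂ (inj₂ e)))   = sym e

Neg-ψ₀ : ∀ {q} → Neg ψ₀ q → q ≡ 0
Neg-ψ₀ (inj₂ (inj₂ e)) = sym e

RLP-cluster : ∀ {i f x} {y : WLP i f} → RLP (inj₁ x) y
RLP-cluster = inj₁ (_ , refl)

RLP-final : ∀ {i f u} → Final (RLP {i} {f}) (inj₂ u)
RLP-final z (inj₂ e) = sym e

φ₀⇒ψ₀-LP₂-valid : Γ-LP₂-1-ω (φ₀ ⇒ ψ₀)
φ₀⇒ψ₀-LP₂-valid i f V x (_ , ◇y) with V 0 x ≟ᵇ true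
... | yes p₀x = inj₁ p₀x
... | no ¬p₀x = inj₂ (◇-map (var 1 ∧ₘ var 0 ∧ₘ ◇ ¬ₘ var 1) (var 0 ∧ₘ ◇ ¬ₘ var 0) witness ◇y)
  where
  open Diamond RLP V

  witness : ∀ y → RLP x y → sat RLP V y (var 1 ∧ₘ var 0 ∧ₘ ◇ ¬ₘ var 1) →
            sat RLP V y (var 0 ∧ₘ ◇ ¬ₘ var 0)
  witness (inj₁ _) _ (_ , p₀y , _)     = p₀y , ◇-intro (¬ₘ var 0) RLP-cluster ¬p₀x
  witness (inj₂ _) _ (p₁y , _ , ◇¬p₁y) = ⊥-elim (final-◇¬-refutes (var 1) RLP-final ◇¬p₁y p₁y)

c-final : Final RLS c
c-final _ ε        = refl
c-final _ (() ◅ _)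

V₁ V₂ : ℕ → Fin 3 → Bool
V₁ _ w = ⌊ w ≟ b ⌋
V₂ _ w = ⌊ w ≟ c ⌋

φ₀-at-V₁ : sat RLS V₁ a φ₀
φ₀-at-V₁ = (λ ()) , ◇-intro (var 1 ∧ₘ var 0 ∧ₘ ◇ ¬ₘ var 1) (ab ◅ ε)
                       (refl , refl , ◇-intro (¬ₘ var 1) (ba ◅ ε) λ ())
  where open Diamond RLS V₁

ψ₀-fails-at-V₂ : ¬ sat RLS V₂ a ψ₀
ψ₀-fails-at-V₂ (inj₁ ())
ψ₀-fails-at-V₂ (inj₂ ◇y) = ◇y refute
  where
  open Diamond RLS V₂

  refute : ∀ y → RLS a y → ¬ sat RLS V₂ y (var 0 ∧ₘ ◇ ¬ₘ var 0)
  refute zero             _ (() , _)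
  refute (suc zero)       _ (() , _)
  refute (suc (suc zero)) _ (p₀c , ◇¬p₀c) = final-◇¬-refutes (var 0) c-final ◇¬p₀c p₀c

data _∼_ : Fin 3 → Fin 3 → Set where
  a∼a : a ∼ a
  c∼_ : ∀ w → c ∼ w
  _∼c : ∀ w → w ∼ c

∼-zig : Forth RLS-base RLS _∼_
∼-zig a∼a    ab = c , ac ◅ ε , b ∼c
∼-zig a∼a    ac = a , ε , c∼ a
∼-zig (_ ∼c) _  = c , ε , _ ∼c

∼-zag : Forth RLS-base RLS (flip _∼_)
∼-zag a∼a    ab = c , ac ◅ ε , c∼ b
∼-zag a∼a    ac = a , ε , a ∼c
∼-zag (c∼ _) _  = c , ε , c∼ _

∼-mono : ∀ {q w₁ w₂} → w₁ ∼ w₂ → V₁ q w₁ ≡ true → V₂ q w₂ ≡ true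
∼-mono (_ ∼c) _ = refl
∼-mono a∼a    ()
∼-mono (c∼ _) ()

open Transfer RLS RLS V₁ V₂ _∼_ (forth-star ∼-zig) (forth-star ∼-zag) U ∅ (λ {q} _ → ∼-mono {q}) (λ ())

theorem9p2 : (L : Fm → Set) → NormalModalLogic L →
    (∀ φ → Γ-LP₂-1-ω φ → L φ) → (∀ φ → L φ → Γ-LS-1-2 φ) →
    ¬ LyndonInterpolation L
theorem9p2 L _ LP₂⊆L L⊆LS lip with lip φ₀ ψ₀ (LP₂⊆L _ φ₀⇒ψ₀-LP₂-valid)
... | ρ , _ , neg , φ₀⇒ρ , ρ⇒ψ₀ = ψ₀-fails-at-V₂ (L⊆LS _ ρ⇒ψ₀ V₂ a ρ-at-V₂)
  where
  ρ-positive : Neg ρ ⊆ ∅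
  ρ-positive {q} h with neg q h
  ... | n₁ , n₂ with trans (sym (Neg-φ₀ n₁)) (Neg-ψ₀ n₂)
  ... | ()

  ρ-at-V₂ : sat RLS V₂ a ρ
  ρ-at-V₂ = preserve ρ _ ρ-positive a∼a (L⊆LS _ φ₀⇒ρ V₁ a φ₀-at-V₁)
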